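{- Let $U$ be an ultrafilter on a countable set $X$ and $I\subseteq U^*$ an ideal on $X$. If $U$ has the $I$-pseudo intersection property, then $U\cdot U\le_T U\times\prod_{n<\omega}I$.
   Context: $U^*=P(X)\setminus U$. $U$ has the $I$-pseudo intersection property if for every sequence $\langle A_n:n<\omega\rangle\subseteq U$ there is $A\in U$ with $A\setminus A_n\in I$ for every $n$. $U\cdot U$ is the filter on $X\times X$ with $A\in U\cdot U$ iff $\{x:\{y:(x,y)\in A\}\in U\}\in U$. Ultrafilters are ordered by $\supseteq$, ideals by $\subseteq$, products coordinatewise. $P\le_TQ$ means there is $f:Q\to P$ mapping cofinal subsets of $Q$ to cofinal subsets of $P$. -}

module Defs where

open import Level using (Level; 0ℓ) renaming (suc to lsuc)
open import Data.Nat using (ℕ)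
open import Data.Product using (Σ; ∃; _×_; _,_; proj₁; proj₂)
open import Data.Sum using (_⊎_)
open import Data.Empty using (⊥)
open import Relation.Nullary using (¬_)
open import Relation.Unary using (Pred; _⊆_; _∈_; _∉_; _∩_; _∪_; ∁; ∅; U; _∖_)
open import Relation.Binary.PropositionalEquality using (_≡_)
open import Function.Definitions using (Injective)

Subset : Set → Set₁
Subset X = Pred X 0ℓ

Family : Set → Set₁
Family X = Pred (Subset X) 0ℓ

Countable : Set → Set
Countable X = Σ (X → ℕ) λ ι → Injective _≡_ _≡_ ι

record IsUltrafilter {X : Set} (𝒰 : Family X) : Set₁ where
  field
    whole    : U ∈ 𝒰
    no-empty : ∅ ∉ 𝒰
    upward   : ∀ {A B : Subset X} → A ∈ 𝒰 → A ⊆ B → B ∈ 𝒰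
    inter    : ∀ {A B : Subset X} → A ∈ 𝒰 → B ∈ 𝒰 → (A ∩ B) ∈ 𝒰
    ultra    : ∀ (A : Subset X) → A ∈ 𝒰 ⊎ ∁ A ∈ 𝒰

record IsIdeal {X : Set} (ℐ : Family X) : Set₁ where
  field
    empty    : ∅ ∈ ℐ
    proper   : U ∉ ℐ
    downward : ∀ {A B : Subset X} → B ∈ ℐ → A ⊆ B → A ∈ ℐ
    union    : ∀ {A B : Subset X} → A ∈ ℐ → B ∈ ℐ → (A ∪ B) ∈ ℐ

-- U* = P(X) ∖ U ; I ⊆ U*
_⊆dual_ : {X : Set} → Family X → Family X → Set₁
ℐ ⊆dual 𝒰 = ∀ A → A ∈ ℐ → A ∉ 𝒰

HasPseudoIntersection : {X : Set} → Family X → Family X → Set₁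
HasPseudoIntersection 𝒰 ℐ =
  ∀ (A : ℕ → Subset _) → (∀ n → A n ∈ 𝒰) →
  Σ (Subset _) λ B → B ∈ 𝒰 × (∀ n → (B ∖ A n) ∈ ℐ)

_·_ : {X : Set} → Family X → Family X → Family (X × X)
(𝒰 · 𝒱) A = (λ x → (λ y → A (x , y)) ∈ 𝒱) ∈ 𝒰

record PO : Set₂ where
  field
    Car : Set₁
    _≤_ : Car → Car → Set
open PO public

Cofinal : (P : PO) → Pred (Car P) (lsuc 0ℓ) → Set₁
Cofinal P C = ∀ (p : Car P) → Σ (Car P) λ c → C c × _≤_ P p c

Img : {A B : Set₁} → (A → B) → Pred A (lsuc 0ℓ) → Pred B (lsuc 0ℓ)
Img f C b = Σ _ λ a → C a × f a ≡ b

_≤T_ : PO → PO → Set₂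
P ≤T Q = Σ (Car Q → Car P) λ f →
  ∀ (C : Pred (Car Q) (lsuc 0ℓ)) → Cofinal Q C → Cofinal P (Img f C)

RevIncl : {X : Set} → Family X → PO
RevIncl {X} 𝒰 = record
  { Car = Σ (Subset X) λ A → A ∈ 𝒰
  ; _≤_ = λ a b → proj₁ b ⊆ proj₁ a }

Incl : {X : Set} → Family X → PO
Incl {X} ℐ = record
  { Car = Σ (Subset X) λ A → A ∈ ℐ
  ; _≤_ = λ a b → proj₁ a ⊆ proj₁ b }

_⊗_ : PO → PO → PO
P ⊗ Q = record
  { Car = Car P × Car Q
  ; _≤_ = λ a b → _≤_ P (proj₁ a) (proj₁ b) × _≤_ Q (proj₂ a) (proj₂ b) }

Πω : PO → PO
Πω P = record
  { Car = ℕ → Car P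
  ; _≤_ = λ a b → ∀ n → _≤_ P (a n) (b n) }

{-# OPTIONS --safe #-}
module Submission where

-- Send (A, ⟨Iₙ⟩) to the set of pairs (x, y) with x, y ∈ A and y ∉ I_{ι x}, where ι enumerates X.
-- This set lies in U·U because each Iₙ is U-small, and the map is monotone. Conversely, for
-- B ∈ U·U let D be the set of x whose section Bₓ lies in U, and Aₙ the section at the point
-- with index n (X if that point is not in D). A pseudo intersection A′ of the Aₙ gives
-- (A′ ∩ D, ⟨A′ ∖ Aₙ⟩), whose image lies inside B. A monotone map with cofinal range is Tukey.

open import Defs
open import Axiom.ExcludedMiddle using (ExcludedMiddle)
open import Axiom.DoubleNegationElimination using (em⇒dne)
open import Level using (0ℓ; lift; lower) renaming (suc to lsuc)
open import Data.Nat using (ℕ)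
open import Data.Product using (Σ; _×_; _,_; proj₁; proj₂)
open import Data.Sum using (inj₁; inj₂)
open import Data.Empty using (⊥-elim)
open import Function.Definitions using (Injective)
open import Relation.Nullary using (yes; no)
open import Relation.Nullary.Decidable using (map′)
open import Relation.Unary using (_∈_; _∉_; _∩_; ∁; _∖_; _⊆_)
open import Relation.Binary.Definitions using (Transitive)
open import Relation.Binary.PropositionalEquality using (_≡_; refl; sym; trans; subst)

em-lower : ExcludedMiddle (lsuc 0ℓ) → ExcludedMiddle 0ℓ
em-lower em = map′ lower lift em

monotone-cofinal⇒≤T : (P Q : PO) → Transitive (_≤_ P) → (f : Car Q → Car P) →
  (∀ q q′ → _≤_ Q q q′ → _≤_ P (f q) (f q′)) →
  (∀ p → Σ (Car Q) λ q → _≤_ P p (f q)) →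
  P ≤T Q
monotone-cofinal⇒≤T P Q ≤-trans f mono cofinal = f , image-cofinal
  where
  image-cofinal : ∀ C → Cofinal Q C → Cofinal P (Img f C)
  image-cofinal C C-cofinal p with cofinal p
  ... | q , p≤fq with C-cofinal q
  ...   | c , c∈C , q≤c = f c , (c , c∈C , refl) , ≤-trans p≤fq (mono q c q≤c)

revIncl-trans : {X : Set} (𝒰 : Family X) → Transitive (_≤_ (RevIncl 𝒰))
revIncl-trans 𝒰 B⊆A C⊆B = λ z → B⊆A (C⊆B z)

module _ {X : Set} {𝒰 : Family X} (uf : IsUltrafilter 𝒰) where
  open IsUltrafilter uf

  ∁-∈-of-dual : {ℐ : Family X} → ℐ ⊆dual 𝒰 → ∀ {A} → A ∈ ℐ → ∁ A ∈ 𝒰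
  ∁-∈-of-dual ℐ⊆𝒰* {A} A∈ℐ with ultra A
  ... | inj₁ A∈𝒰  = ⊥-elim (ℐ⊆𝒰* A A∈ℐ A∈𝒰)
  ... | inj₂ ∁A∈𝒰 = ∁A∈𝒰

  section : Subset (X × X) → X → Subset X
  section B x y = B (x , y)

  -- The section Bₓ at the x (unique when ι is injective) with ι x ≡ n and Bₓ ∈ 𝒰; X when there is none.
  sectionAt : (X → ℕ) → Subset (X × X) → ℕ → Subset X
  sectionAt ι B n y = ∀ x → ι x ≡ n → section B x ∈ 𝒰 → B (x , y)

  sectionAt∈ : ExcludedMiddle 0ℓ → (ι : X → ℕ) → Injective _≡_ _≡_ ι →
    ∀ B n → sectionAt ι B n ∈ 𝒰
  sectionAt∈ em ι ι-inj B n with em {Σ X λ x → ι x ≡ n × section B x ∈ 𝒰}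
  ... | yes (x , ιx≡n , Bₓ∈𝒰) = upward Bₓ∈𝒰 λ {y} Bxy x′ ιx′≡n _ →
          subst (λ z → B (z , y)) (ι-inj (trans ιx≡n (sym ιx′≡n))) Bxy
  ... | no ∄x = upward whole λ _ x ιx≡n Bₓ∈𝒰 → ⊥-elim (∄x (x , ιx≡n , Bₓ∈𝒰))

  module _ {ℐ : Family X} (ℐ⊆𝒰* : ℐ ⊆dual 𝒰) (ι : X → ℕ) where

    fubiniSet : Car (RevIncl 𝒰 ⊗ Πω (Incl ℐ)) → Subset (X × X)
    fubiniSet ((A , _) , I) (x , y) = A x × A y × y ∉ proj₁ (I (ι x))

    fubiniSet∈ : ∀ q → fubiniSet q ∈ 𝒰 · 𝒰
    fubiniSet∈ ((A , A∈𝒰) , I) = upward A∈𝒰 λ {x} Ax →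
      upward (inter A∈𝒰 (∁-∈-of-dual ℐ⊆𝒰* (proj₂ (I (ι x)))))
        λ (Ay , y∉Iₓ) → Ax , Ay , y∉Iₓ

    fubini : Car (RevIncl 𝒰 ⊗ Πω (Incl ℐ)) → Car (RevIncl (𝒰 · 𝒰))
    fubini q = fubiniSet q , fubiniSet∈ q

    fubini-mono : ∀ q q′ → _≤_ (RevIncl 𝒰 ⊗ Πω (Incl ℐ)) q q′ →
      _≤_ (RevIncl (𝒰 · 𝒰)) (fubini q) (fubini q′)
    fubini-mono _ _ (A′⊆A , I≤I′) {x , y} (A′x , A′y , y∉I′ₓ) =
      A′⊆A A′x , A′⊆A A′y , λ y∈Iₓ → y∉I′ₓ (I≤I′ (ι x) y∈Iₓ)

    fubini-cofinal : ExcludedMiddle 0ℓ → Injective _≡_ _≡_ ι →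
      HasPseudoIntersection 𝒰 ℐ →
      ∀ p → Σ (Car (RevIncl 𝒰 ⊗ Πω (Incl ℐ))) λ q →
              _≤_ (RevIncl (𝒰 · 𝒰)) p (fubini q)
    fubini-cofinal em ι-inj pip (B , B∈𝒰·𝒰) = q , image⊆B
      where
      D : Subset X
      D x = section B x ∈ 𝒰
      Aₙ : ℕ → Subset X
      Aₙ = sectionAt ι B
      A′-pseudo : Σ (Subset X) λ A′ → A′ ∈ 𝒰 × (∀ n → (A′ ∖ Aₙ n) ∈ ℐ)
      A′-pseudo = pip Aₙ (sectionAt∈ em ι ι-inj B)
      A′ = proj₁ A′-pseudo
      q : Car (RevIncl 𝒰 ⊗ Πω (Incl ℐ))
      q = (A′ ∩ D , inter (proj₁ (proj₂ A′-pseudo)) B∈𝒰·𝒰)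
        , λ n → A′ ∖ Aₙ n , proj₂ (proj₂ A′-pseudo) n
      image⊆B : fubiniSet q ⊆ B
      image⊆B {x , y} ((_ , Dx) , (A′y , _) , y∉A′∖Aₙ) =
        em⇒dne em λ ¬Bxy → y∉A′∖Aₙ (A′y , λ Aₙy → ¬Bxy (Aₙy x refl Dx))

proposition1p13 : ExcludedMiddle (lsuc 0ℓ) →
    (X : Set) → Countable X →
    (𝒰 : Family X) → IsUltrafilter 𝒰 →
    (ℐ : Family X) → IsIdeal ℐ → ℐ ⊆dual 𝒰 →
    HasPseudoIntersection 𝒰 ℐ →
    RevIncl (𝒰 · 𝒰) ≤T (RevIncl 𝒰 ⊗ Πω (Incl ℐ))
proposition1p13 em X (ι , ι-inj) 𝒰 uf ℐ _ ℐ⊆𝒰* pip =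
  monotone-cofinal⇒≤T (RevIncl (𝒰 · 𝒰)) (RevIncl 𝒰 ⊗ Πω (Incl ℐ))
    (λ {a b c} → revIncl-trans (𝒰 · 𝒰) {a} {b} {c})
    (fubini uf ℐ⊆𝒰* ι) (fubini-mono uf ℐ⊆𝒰* ι)
    (fubini-cofinal uf ℐ⊆𝒰* ι (em-lower em) ι-inj pip)
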